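{- For every integer $r\geq 7$, $\dim_s(P_5\diamond P_r)=\dim_s(P_5\diamond C_r)=3r-2$.
   Context: $P_n$ and $C_n$ are the path and cycle on $n$ vertices. The modular product $G\diamond H$ has vertex set $V(G)\times V(H)$, and $(g,h)$, $(g',h')$ are adjacent if $g=g'$ and $hh'\in E(H)$, or $gg'\in E(G)$ and $h=h'$, or $gg'\in E(G)$ and $hh'\in E(H)$, or ($g\neq g'$, $h\neq h'$, $gg'\notin E(G)$ and $hh'\notin E(H)$). $\dim_s(X)$ is the strong metric dimension: the minimum size of $S\subseteq V(X)$ such that for all distinct $x,y$ some $z\in S$ satisfies $d_X(y,z)=d_X(y,x)+d_X(x,z)$ or $d_X(x,z)=d_X(x,y)+d_X(y,z)$. -}

module Defs where

open import Level using (0ℓ)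
open import Data.Nat using (ℕ; zero; suc; _+_; _<_; _≤_)
open import Data.Fin using (Fin; toℕ)
open import Data.Product using (Σ; ∃; ∃-syntax; _×_; _,_)
open import Data.Sum using (_⊎_)
open import Data.List using (List; length)
open import Data.List.Membership.Propositional using (_∈_)
open import Data.List.Relation.Unary.Unique.Propositional using (Unique)
open import Relation.Nullary using (¬_)
open import Relation.Binary.PropositionalEquality using (_≡_; _≢_)

record Graph : Set₁ where
  field
    V   : Set
    Adj : V → V → Set
open Graph public

P : ℕ → Graph
V (P n) = Fin n
Adj (P n) i j = (toℕ j ≡ suc (toℕ i)) ⊎ (toℕ i ≡ suc (toℕ j))

-- Cycle C_n on vertices 0,…,n-1 (used for n ≥ 3): i ~ j iff j ≡ i ± 1 (mod n).
C : ℕ → Graph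
V (C n) = Fin n
Adj (C n) i j =
  (toℕ j ≡ suc (toℕ i)) ⊎ (toℕ i ≡ suc (toℕ j))
  ⊎ ((toℕ i ≡ 0) × (suc (toℕ j) ≡ n))
  ⊎ ((toℕ j ≡ 0) × (suc (toℕ i) ≡ n))

_⋄_ : Graph → Graph → Graph
V (G ⋄ H) = V G × V H
Adj (G ⋄ H) (g , h) (g' , h') =
  ((g ≡ g') × Adj H h h')
  ⊎ (Adj G g g' × (h ≡ h'))
  ⊎ (Adj G g g' × Adj H h h')
  ⊎ ((g ≢ g') × (h ≢ h') × ¬ Adj G g g' × ¬ Adj H h h')

data Walk (G : Graph) : V G → V G → ℕ → Set where
  nil  : ∀ {x} → Walk G x x 0
  cons : ∀ {x y z k} → Adj G x y → Walk G y z k → Walk G x z (suc k)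

Dist : (G : Graph) → V G → V G → ℕ → Set
Dist G x y k = Walk G x y k × (∀ m → m < k → ¬ Walk G x y m)

OnGeodesic : (G : Graph) → V G → V G → V G → Set
OnGeodesic G y x z = ∃[ a ] ∃[ b ] (Dist G y x a × Dist G x z b × Dist G y z (a + b))

StronglyResolvesPair : (G : Graph) → V G → V G → V G → Set
StronglyResolvesPair G z x y = OnGeodesic G y x z ⊎ OnGeodesic G x y z

StrongResolvingSet : (G : Graph) → List (V G) → Set
StrongResolvingSet G S =
  ∀ x y → x ≢ y → ∃[ z ] ((z ∈ S) × StronglyResolvesPair G z x y)

StrongMetricDim : (G : Graph) → ℕ → Set
StrongMetricDim G k =
  (∃[ S ] (Unique S × length S ≡ k × StrongResolvingSet G S))
  × (∀ S → Unique S → StrongResolvingSet G S → k ≤ length S)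

{-# OPTIONS --safe #-}
module Submission where

open import Defs
open import Data.Nat using (ℕ; _≤_; _*_; _∸_)
open import Data.Product using (_×_)

open import Level using (0ℓ)
open import Data.Bool using (Bool; true; false; T)
open import Data.Empty using (⊥; ⊥-elim)
open import Data.Fin as Fin using (Fin; zero; suc; toℕ)
open import Data.Fin.Properties using (_≟_; all?; any?; pigeonhole)
import Data.Fin.Properties as Finₚ
open import Data.List using (List; []; _∷_; length; map; _++_; filter; allFin; lookup)
open import Data.List.Membership.Propositional using (_∈_; _∉_)
open import Data.List.Membership.Propositional.Properties
  using (∈-allFin; ∈-map⁺; ∈-map⁻; ∈-filter⁺; ∈-filter⁻; ∈-++⁺ˡ; ∈-++⁺ʳ; ∈-++⁻)
open import Data.List.Properties using (length-map; length-++; length-tabulate)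
open import Data.List.Relation.Unary.Any using (here; there; index)
open import Data.List.Relation.Unary.Any.Properties using (lookup-index)
open import Data.List.Relation.Unary.All using (_∷_)
open import Data.List.Relation.Unary.AllPairs using (_∷_)
open import Data.List.Relation.Unary.Unique.Propositional using (Unique)
import Data.List.Relation.Unary.Unique.Propositional.Properties as Unique
open import Data.List.Relation.Binary.Disjoint.Propositional using (Disjoint)
open import Data.Nat using (zero; suc; _+_; z≤n; s≤s; _≤?_)
import Data.Nat as ℕ
open import Data.Nat.Properties
  using (<-cmp; ≰⇒>; <⇒≱; <⇒≢; ≤-refl; ≤-trans; +-identityʳ; +-suc; +-cancelˡ-≤; n≤0⇒n≡0; 1+n≢n; 1+n≰n;
         m≢1+n+m; +-mono-≤; +-monoˡ-≤; m≤m+n; m≤n+m; m≤n+o⇒m∸n≤o; +-∸-assoc; m≤n⇒∃[o]m+o≡n; module ≤-Reasoning)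
open import Data.Product using (∃; ∃₂; ∃-syntax; _,_; proj₁; proj₂; map₁; map₂)
open import Data.Sum using (_⊎_; inj₁; inj₂; [_,_]′; swap) renaming (map to map-⊎)
open import Function using (_∘_; id)
open import Function.Definitions using (Injective)
open import Relation.Binary using (Rel; Decidable; DecidableEquality; Symmetric; Irreflexive; tri<; tri≈; tri>)
open import Relation.Binary.PropositionalEquality
  using (_≡_; _≢_; refl; sym; trans; cong; cong₂; subst; module ≡-Reasoning)
open import Relation.Nullary using (¬_; Dec; yes; no; contradiction)
open import Relation.Nullary.Decidable
  using (T?; isYes; fromWitness; from-yes; decidable-stable; _×-dec_; _⊎-dec_; map′)
open import Relation.Unary using (Pred)
import Relation.Unary as U
open import Relation.Unary.Properties using (∁?)

-- For the graphs H at hand (triangle-free, any two vertices have a common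
-- non-neighbour, no edge is a component) the distance from (g , h) to (g' , h') in
-- P₅ ⋄ H only depends on g, g' and on whether h, h' are equal, adjacent or apart, so
-- it is given by a finite table. By that table (0 , h) and (3 , h) are at
-- distance 3, the diameter, and every vertex lies on a geodesic between them; the
-- same holds for (1 , h) and (4 , h). Two distinct non-adjacent vertices of row 2
-- are at distance 2, the eccentricity of every vertex of row 2. A strong resolving
-- set contains one of any two mutually maximally distant vertices, so it meets
-- every pair {(0 , h) , (3 , h)} and {(1 , h) , (4 , h)}, and it misses only a
-- clique of row 2, that is at most two of its vertices: it has at least 3r − 2
-- vertices. Conversely, rows 3 and 4 together with row 2 without (2 , 0) and
-- (2 , 1), for an edge 0 ~ 1 of H, resolve strongly: a vertex of row 0 or 1 lies on
-- a geodesic from any other vertex to its partner in row 3 or 4, and (2 , 1) lies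
-- on a geodesic from (2 , 0) to (2 , 2).

m+n≤m⇒n≡0 : ∀ {m n} → m + n ≤ m → n ≡ 0
m+n≤m⇒n≡0 {m} {n} m+n≤m = n≤0⇒n≡0 (+-cancelˡ-≤ m n 0 (subst (m + n ≤_) (sym (+-identityʳ m)) m+n≤m))

3*n∸2≡n+[n+[n∸2]] : ∀ n → 2 ≤ n → 3 * n ∸ 2 ≡ n + (n + (n ∸ 2))
3*n∸2≡n+[n+[n∸2]] n 2≤n = begin
  3 * n ∸ 2         ≡⟨ cong (λ k → n + (n + k) ∸ 2) (+-identityʳ n) ⟩
  n + (n + n) ∸ 2   ≡⟨ +-∸-assoc n (≤-trans 2≤n (m≤n+m n n)) ⟩
  n + (n + n ∸ 2)   ≡⟨ cong (n +_) (+-∸-assoc n 2≤n) ⟩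
  n + (n + (n ∸ 2)) ∎
  where open ≡-Reasoning

length-filter-∁ : ∀ {A : Set} {P : Pred A 0ℓ} (P? : U.Decidable P) xs →
                  length (filter P? xs) + length (filter (∁? P?) xs) ≡ length xs
length-filter-∁ P? []       = refl
length-filter-∁ P? (x ∷ xs) with P? x
... | yes _ = cong suc (length-filter-∁ P? xs)
... | no  _ = trans (+-suc _ _) (cong suc (length-filter-∁ P? xs))

pigeonhole-length : ∀ {m} {A : Set} (f : Fin m → A) → Injective _≡_ _≡_ f →
                    (xs : List A) → (∀ i → f i ∈ xs) → m ≤ length xs
pigeonhole-length {m} f f-injective xs f∈xs with m ≤? length xs
... | yes m≤ = m≤
... | no  m≰ with i , j , i<j , same-index ← pigeonhole (≰⇒> m≰) (index ∘ f∈xs) =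
  contradiction (f-injective f[i]≡f[j]) (Finₚ.<⇒≢ i<j)
  where
  f[i]≡f[j] : f i ≡ f j
  f[i]≡f[j] = trans (lookup-index (f∈xs i)) (trans (cong (lookup xs) same-index) (sym (lookup-index (f∈xs j))))

module _ {G : Graph} where

  Dist-unique : ∀ {x y a b} → Dist G x y a → Dist G x y b → a ≡ b
  Dist-unique {a = a} {b} (walkᵃ , minᵃ) (walkᵇ , minᵇ) with <-cmp a b
  ... | tri< a<b _ _ = contradiction walkᵃ (minᵇ a a<b)
  ... | tri≈ _ a≡b _ = a≡b
  ... | tri> _ _ b<a = contradiction walkᵇ (minᵃ b b<a)

  Dist-refl : ∀ {x} → Dist G x x 0
  Dist-refl = nil , λ _ ()

  Dist-0⇒≡ : ∀ {x y} → Dist G x y 0 → x ≡ y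
  Dist-0⇒≡ (nil , _) = refl

  OnGeodesic-end : ∀ {y x d} → Dist G y x d → OnGeodesic G y x x
  OnGeodesic-end {d = d} D = d , 0 , D , Dist-refl , subst (Dist G _ _) (sym (+-identityʳ d)) D

  EccentricityAtMost : V G → ℕ → Set
  EccentricityAtMost x k = ∀ z {d} → Dist G x z d → d ≤ k

  -- A geodesic from y through x to z has length d(y , x) + d(x , z) ≤ ecc y = d(y , x),
  -- so it ends at x.
  mutuallyMaximallyDistant-∈ : ∀ {S x y k} → StrongResolvingSet G S → x ≢ y →
    Dist G x y k → Dist G y x k → EccentricityAtMost x k → EccentricityAtMost y k → x ∈ S ⊎ y ∈ S
  mutuallyMaximallyDistant-∈ {S} {x} {y} resolving x≢y Dxy Dyx eccˣ eccʸ with resolving x y x≢y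
  ... | z , z∈S , inj₁ (_ , _ , Dyx′ , Dxz , Dyz) rewrite Dist-unique Dyx′ Dyx =
    inj₁ (subst (_∈ S) (sym (Dist-0⇒≡ (subst (Dist G x z) (m+n≤m⇒n≡0 (eccʸ z Dyz)) Dxz))) z∈S)
  ... | z , z∈S , inj₂ (_ , _ , Dxy′ , Dyz , Dxz) rewrite Dist-unique Dxy′ Dxy =
    inj₂ (subst (_∈ S) (sym (Dist-0⇒≡ (subst (Dist G y z) (m+n≤m⇒n≡0 (eccˣ z Dxz)) Dyz))) z∈S)

TriangleFree : {A : Set} → Rel A 0ℓ → Set
TriangleFree _~_ = ∀ {x y z} → x ~ y → y ~ z → x ~ z → ⊥

CommonNonNeighbours : {A : Set} → Rel A 0ℓ → Set
CommonNonNeighbours _~_ = ∀ x y → ∃[ f ] (f ≢ x × f ≢ y × ¬ x ~ f × ¬ y ~ f)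

NoIsolatedEdge : {A : Set} → Rel A 0ℓ → Set
NoIsolatedEdge _~_ = ∀ {x y} → x ~ y → ∃[ w ] ((x ~ w × w ≢ y) ⊎ (y ~ w × w ≢ x))

clique-length≤2 : ∀ {A : Set} {_~_ : Rel A 0ℓ} → TriangleFree _~_ →
  (xs : List A) → Unique xs → (∀ {x y} → x ∈ xs → y ∈ xs → x ≢ y → x ~ y) → length xs ≤ 2
clique-length≤2 _ []               _ _ = z≤n
clique-length≤2 _ (_ ∷ [])         _ _ = s≤s z≤n
clique-length≤2 _ (_ ∷ _ ∷ [])     _ _ = s≤s (s≤s z≤n)
clique-length≤2 triangleFree (x ∷ y ∷ z ∷ ws) ((x≢y ∷ x≢z ∷ _) ∷ (y≢z ∷ _) ∷ _) clique =
  ⊥-elim (triangleFree (clique x∈ y∈ x≢y) (clique y∈ z∈ y≢z) (clique x∈ z∈ x≢z))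
  where
  x∈ : x ∈ x ∷ y ∷ z ∷ ws
  x∈ = here refl
  y∈ : y ∈ x ∷ y ∷ z ∷ ws
  y∈ = there (here refl)
  z∈ : z ∈ x ∷ y ∷ z ∷ ws
  z∈ = there (there (here refl))

module _ {n} {_~_ : Rel (Fin n) 0ℓ} (_~?_ : Decidable _~_) (triangleFree : TriangleFree _~_) where
  open import Data.List.Membership.DecPropositional (_≟_ {n}) using (_∈?_; _∉?_)

  -- The vertices outside such a cover form a clique.
  nonEdgeCover-length : (C : List (Fin n)) → (∀ {x y} → x ≢ y → ¬ x ~ y → x ∈ C ⊎ y ∈ C) → n ≤ 2 + length C
  nonEdgeCover-length C covers = begin
    n                         ≤⟨ pigeonhole-length id id (outside ++ C) every∈ ⟩
    length (outside ++ C)     ≡⟨ length-++ outside ⟩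
    length outside + length C ≤⟨ +-monoˡ-≤ (length C) (clique-length≤2 triangleFree outside outside-unique outside-clique) ⟩
    2 + length C              ∎
    where
    open ≤-Reasoning
    outside : List (Fin n)
    outside = filter (_∉? C) (allFin n)

    every∈ : ∀ x → x ∈ outside ++ C
    every∈ x with x ∈? C
    ... | yes x∈C = ∈-++⁺ʳ outside x∈C
    ... | no  x∉C = ∈-++⁺ˡ (∈-filter⁺ (_∉? C) (∈-allFin x) x∉C)

    outside-unique : Unique outside
    outside-unique = Unique.filter⁺ (_∉? C) (Unique.allFin⁺ n)

    outside-clique : ∀ {x y} → x ∈ outside → y ∈ outside → x ≢ y → x ~ y
    outside-clique {x} {y} x∈ y∈ x≢y with x ~? y
    ... | yes x~y = x~y
    ... | no  x≁y = ⊥-elim ([ outside⇒∉ x∈ , outside⇒∉ y∈ ]′ (covers x≢y x≁y))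
      where
      outside⇒∉ : ∀ {z} → z ∈ outside → z ∉ C
      outside⇒∉ = proj₂ ∘ ∈-filter⁻ (_∉? C) {xs = allFin n}

data Kind : Set where
  equal adjacent apart : Kind

_≟ᴷ_ : DecidableEquality Kind
equal    ≟ᴷ equal    = yes refl
adjacent ≟ᴷ adjacent = yes refl
apart    ≟ᴷ apart    = yes refl
equal    ≟ᴷ adjacent = no λ ()
equal    ≟ᴷ apart    = no λ ()
adjacent ≟ᴷ equal    = no λ ()
adjacent ≟ᴷ apart    = no λ ()
apart    ≟ᴷ equal    = no λ ()
apart    ≟ᴷ adjacent = no λ ()

anyKind? : {P : Kind → Set} → (∀ t → Dec (P t)) → Dec (∃ P)
anyKind? P? = map′ [ (equal ,_) , [ (adjacent ,_) , (apart ,_) ]′ ]′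
                   (λ { (equal , p) → inj₁ p ; (adjacent , p) → inj₂ (inj₁ p) ; (apart , p) → inj₂ (inj₂ p) })
                   (P? equal ⊎-dec P? adjacent ⊎-dec P? apart)

allKinds? : {P : Kind → Set} → (∀ t → Dec (P t)) → Dec (∀ t → P t)
allKinds? P? = map′ (λ (e , a , n) → λ { equal → e ; adjacent → a ; apart → n })
                    (λ ∀P → ∀P equal , ∀P adjacent , ∀P apart)
                    (P? equal ×-dec P? adjacent ×-dec P? apart)

data IsKind {A : Set} (_~_ : Rel A 0ℓ) (x y : A) : Kind → Set where
  is-equal    : x ≡ y → IsKind _~_ x y equal
  is-adjacent : x ~ y → IsKind _~_ x y adjacent
  is-apart    : x ≢ y → ¬ x ~ y → IsKind _~_ x y apart

module _ {A : Set} {_~_ : Rel A 0ℓ} where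

  IsKind-functional : Irreflexive _≡_ _~_ → ∀ {x y s t} → IsKind _~_ x y s → IsKind _~_ x y t → s ≡ t
  IsKind-functional _   (is-equal _)      (is-equal _)      = refl
  IsKind-functional _   (is-adjacent _)   (is-adjacent _)   = refl
  IsKind-functional _   (is-apart _ _)    (is-apart _ _)    = refl
  IsKind-functional irr (is-equal x≡y)    (is-adjacent x~y) = ⊥-elim (irr x≡y x~y)
  IsKind-functional irr (is-adjacent x~y) (is-equal x≡y)    = ⊥-elim (irr x≡y x~y)
  IsKind-functional _   (is-equal x≡y)    (is-apart x≢y _)  = ⊥-elim (x≢y x≡y)
  IsKind-functional _   (is-apart x≢y _)  (is-equal x≡y)    = ⊥-elim (x≢y x≡y)
  IsKind-functional _   (is-adjacent x~y) (is-apart _ x≁y)  = ⊥-elim (x≁y x~y)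
  IsKind-functional _   (is-apart _ x≁y)  (is-adjacent x~y) = ⊥-elim (x≁y x~y)

  IsKind-sym : Symmetric _~_ → ∀ {x y t} → IsKind _~_ x y t → IsKind _~_ y x t
  IsKind-sym _     (is-equal x≡y)     = is-equal (sym x≡y)
  IsKind-sym ~-sym (is-adjacent x~y)  = is-adjacent (~-sym x~y)
  IsKind-sym ~-sym (is-apart x≢y x≁y) = is-apart (x≢y ∘ sym) (x≁y ∘ ~-sym)

  IsKind-equal : ∀ {x y} → IsKind _~_ x y equal → x ≡ y
  IsKind-equal (is-equal x≡y) = x≡y

  IsKind-adjacent : ∀ {x y} → IsKind _~_ x y adjacent → x ~ y
  IsKind-adjacent (is-adjacent x~y) = x~y

module KindOf {A : Set} {_~_ : Rel A 0ℓ} (_≟_ : DecidableEquality A) (_~?_ : Decidable _~_) where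

  kind : A → A → Kind
  kind x y with x ≟ y | x ~? y
  ... | yes _ | _     = equal
  ... | no _  | yes _ = adjacent
  ... | no _  | no _  = apart

  kind-view : ∀ x y → IsKind _~_ x y (kind x y)
  kind-view x y with x ≟ y | x ~? y
  ... | yes x≡y | _       = is-equal x≡y
  ... | no  x≢y | yes x~y = is-adjacent x~y
  ... | no  x≢y | no  x≁y = is-apart x≢y x≁y

modular : Kind → Kind → Bool
modular equal    adjacent = true
modular adjacent equal    = true
modular adjacent adjacent = true
modular apart    apart    = true
modular _        _        = false

module _ {G H : Graph} where

  modular⇒Adj : ∀ {g g' h h' s t} → IsKind (Adj G) g g' s → IsKind (Adj H) h h' t →
                T (modular s t) → Adj (G ⋄ H) (g , h) (g' , h')
  modular⇒Adj (is-equal refl)      (is-adjacent h~h')   _ = inj₁ (refl , h~h')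
  modular⇒Adj (is-adjacent g~g')   (is-equal refl)      _ = inj₂ (inj₁ (g~g' , refl))
  modular⇒Adj (is-adjacent g~g')   (is-adjacent h~h')   _ = inj₂ (inj₂ (inj₁ (g~g' , h~h')))
  modular⇒Adj (is-apart g≢g' g≁g') (is-apart h≢h' h≁h') _ = inj₂ (inj₂ (inj₂ (g≢g' , h≢h' , g≁g' , h≁h')))
  modular⇒Adj (is-equal _)         (is-equal _)         ()
  modular⇒Adj (is-equal _)         (is-apart _ _)       ()
  modular⇒Adj (is-adjacent _)      (is-apart _ _)       ()
  modular⇒Adj (is-apart _ _)       (is-equal _)         ()
  modular⇒Adj (is-apart _ _)       (is-adjacent _)      ()

  Adj⇒modular : Irreflexive _≡_ (Adj G) → Irreflexive _≡_ (Adj H) → ∀ {g g' h h' s t} →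
                Adj (G ⋄ H) (g , h) (g' , h') → IsKind (Adj G) g g' s → IsKind (Adj H) h h' t → T (modular s t)
  Adj⇒modular irrG irrH (inj₁ (refl , h~h')) vg vh
    with refl ← IsKind-functional irrG vg (is-equal refl) | refl ← IsKind-functional irrH vh (is-adjacent h~h') = _
  Adj⇒modular irrG irrH (inj₂ (inj₁ (g~g' , refl))) vg vh
    with refl ← IsKind-functional irrG vg (is-adjacent g~g') | refl ← IsKind-functional irrH vh (is-equal refl) = _
  Adj⇒modular irrG irrH (inj₂ (inj₂ (inj₁ (g~g' , h~h')))) vg vh
    with refl ← IsKind-functional irrG vg (is-adjacent g~g') | refl ← IsKind-functional irrH vh (is-adjacent h~h') = _
  Adj⇒modular irrG irrH (inj₂ (inj₂ (inj₂ (g≢g' , h≢h' , g≁g' , h≁h')))) vg vh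
    with refl ← IsKind-functional irrG vg (is-apart g≢g' g≁g') | refl ← IsKind-functional irrH vh (is-apart h≢h' h≁h') = _

-- The triples of kinds of xy, yz and xz that three vertices x, y, z of a triangle-free
-- graph can have.
consistent : Kind → Kind → Kind → Bool
consistent equal    s        t        = isYes (s ≟ᴷ t)
consistent adjacent equal    t        = isYes (adjacent ≟ᴷ t)
consistent apart    equal    t        = isYes (apart ≟ᴷ t)
consistent adjacent adjacent adjacent = false
consistent adjacent apart    equal    = false
consistent apart    adjacent equal    = false
consistent _        _        _        = true

module _ {A : Set} {_~_ : Rel A 0ℓ} (~-sym : Symmetric _~_) (triangleFree : TriangleFree _~_) where

  private
    ~-irrefl : Irreflexive _≡_ _~_
    ~-irrefl refl x~x = triangleFree x~x x~x x~x

  consistent-sound : ∀ {x y z r s t} → IsKind _~_ x y r → IsKind _~_ y z s → IsKind _~_ x z t → T (consistent r s t)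
  consistent-sound (is-equal refl)    yz                xz = fromWitness (IsKind-functional ~-irrefl yz xz)
  consistent-sound xy@(is-adjacent _) (is-equal refl)   xz = fromWitness (IsKind-functional ~-irrefl xy xz)
  consistent-sound xy@(is-apart _ _)  (is-equal refl)   xz = fromWitness (IsKind-functional ~-irrefl xy xz)
  consistent-sound (is-adjacent x~y)  (is-adjacent y~z) (is-adjacent x~z) = triangleFree x~y y~z x~z
  consistent-sound (is-adjacent x~y)  (is-apart _ y≁x)  (is-equal refl)   = y≁x (~-sym x~y)
  consistent-sound (is-apart _ x≁y)   (is-adjacent y~x) (is-equal refl)   = x≁y (~-sym y~x)
  consistent-sound (is-adjacent _)    (is-adjacent _)   (is-equal _)      = _
  consistent-sound (is-adjacent _)    (is-adjacent _)   (is-apart _ _)    = _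
  consistent-sound (is-adjacent _)    (is-apart _ _)    (is-adjacent _)   = _
  consistent-sound (is-adjacent _)    (is-apart _ _)    (is-apart _ _)    = _
  consistent-sound (is-apart _ _)     (is-adjacent _)   (is-adjacent _)   = _
  consistent-sound (is-apart _ _)     (is-adjacent _)   (is-apart _ _)    = _
  consistent-sound (is-apart _ _)     (is-apart _ _)    (is-equal _)      = _
  consistent-sound (is-apart _ _)     (is-apart _ _)    (is-adjacent _)   = _
  consistent-sound (is-apart _ _)     (is-apart _ _)    (is-apart _ _)    = _

P-adj? : ∀ n → Decidable (Adj (P n))
P-adj? n i j = (toℕ j ℕ.≟ suc (toℕ i)) ⊎-dec (toℕ i ℕ.≟ suc (toℕ j))

P-irrefl : ∀ {n} → Irreflexive _≡_ (Adj (P n))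
P-irrefl refl (inj₁ i≡1+i) = 1+n≢n (sym i≡1+i)
P-irrefl refl (inj₂ i≡1+i) = 1+n≢n (sym i≡1+i)

pattern 0F = zero
pattern 1F = suc zero
pattern 2F = suc (suc zero)
pattern 3F = suc (suc (suc zero))
pattern 4F = suc (suc (suc (suc zero)))

open KindOf {A = Fin 5} _≟_ (P-adj? 5) using () renaming (kind to kind₅; kind-view to kind₅-view)

Step : Kind → Fin 5 → Fin 5 → Set
Step t g g' = T (modular (kind₅ g g') t)

step? : ∀ t g g' → Dec (Step t g g')
step? t g g' = T? (modular (kind₅ g g') t)

_⨾_ : (R S : Fin 5 → Fin 5 → Set) → Fin 5 → Fin 5 → Set
(R ⨾ S) g g' = ∃[ g₂ ] (R g g₂ × S g₂ g')

_⨾?_ : ∀ {R S} → (∀ g g' → Dec (R g g')) → (∀ g g' → Dec (S g g')) → ∀ g g' → Dec ((R ⨾ S) g g')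
(R? ⨾? S?) g g' = any? λ g₂ → R? g g₂ ×-dec S? g₂ g'

Reachable₀ : Kind → Fin 5 → Fin 5 → Set
Reachable₀ t g g' = g ≡ g' × t ≡ equal

reachable₀? : ∀ t g g' → Dec (Reachable₀ t g g')
reachable₀? t g g' = (g ≟ g') ×-dec (t ≟ᴷ equal)

Possible₂ : Kind → Fin 5 → Fin 5 → Set
Possible₂ t g g' = ∃₂ λ t₁ t₂ → T (consistent t₁ t₂ t) × (Step t₁ ⨾ Step t₂) g g'

possible₂? : ∀ t g g' → Dec (Possible₂ t g g')
possible₂? t g g' = anyKind? λ t₁ → anyKind? λ t₂ → T? (consistent t₁ t₂ t) ×-dec (step? t₁ ⨾? step? t₂) g g'

-- The middle vertex of H is h, h', a common non-neighbour of h and h', or, when h ~ h',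
-- a further neighbour of h or of h'; which of the two exists is not known, so both
-- routes must be available.
Reachable₂ : Kind → Fin 5 → Fin 5 → Set
Reachable₂ t g g' = (Step equal ⨾ Step t) g g' ⊎ (Step t ⨾ Step equal) g g' ⊎ (Step apart ⨾ Step apart) g g'
                  ⊎ t ≡ adjacent × (Step adjacent ⨾ Step apart) g g' × (Step apart ⨾ Step adjacent) g g'

reachable₂? : ∀ t g g' → Dec (Reachable₂ t g g')
reachable₂? t g g' = (step? equal ⨾? step? t) g g' ⊎-dec (step? t ⨾? step? equal) g g' ⊎-dec (step? apart ⨾? step? apart) g g'
                   ⊎-dec (t ≟ᴷ adjacent) ×-dec (step? adjacent ⨾? step? apart) g g' ×-dec (step? apart ⨾? step? adjacent) g g'

Reachable₃ : Kind → Fin 5 → Fin 5 → Set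
Reachable₃ t = Step equal ⨾ (Step equal ⨾ Step t)

reachable₃? : ∀ t g g' → Dec (Reachable₃ t g g')
reachable₃? t = step? equal ⨾? (step? equal ⨾? step? t)

firstTrue : Bool → Bool → Bool → ℕ
firstTrue true  _     _     = 0
firstTrue false true  _     = 1
firstTrue false false true  = 2
firstTrue false false false = 3

firstTrue-≤₀ : ∀ {b₀ b₁ b₂} → T b₀ → firstTrue b₀ b₁ b₂ ≤ 0
firstTrue-≤₀ {true} _ = z≤n

firstTrue-≤₁ : ∀ {b₀ b₁ b₂} → T b₁ → firstTrue b₀ b₁ b₂ ≤ 1
firstTrue-≤₁ {true}         _ = z≤n
firstTrue-≤₁ {false} {true} _ = s≤s z≤n

firstTrue-≤₂ : ∀ {b₀ b₁ b₂} → T b₂ → firstTrue b₀ b₁ b₂ ≤ 2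
firstTrue-≤₂ {true}                 _ = z≤n
firstTrue-≤₂ {false} {true}         _ = s≤s z≤n
firstTrue-≤₂ {false} {false} {true} _ = s≤s (s≤s z≤n)

firstTrue-≤₃ : ∀ b₀ b₁ b₂ → firstTrue b₀ b₁ b₂ ≤ 3
firstTrue-≤₃ true  _     _     = z≤n
firstTrue-≤₃ false true  _     = s≤s z≤n
firstTrue-≤₃ false false true  = s≤s (s≤s z≤n)
firstTrue-≤₃ false false false = s≤s (s≤s (s≤s z≤n))

-- The distance from (g , h) to (g' , h') in P₅ ⋄ H when h and h' are of kind t: the
-- least length that the necessary conditions Step and Possible₂ on walks of length 1
-- and 2 do not rule out. By distance-realizable, the sufficient conditions Realizable
-- provide a walk of that length.
distance : Kind → Fin 5 → Fin 5 → ℕ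
distance t g g' = firstTrue (isYes (reachable₀? t g g')) (isYes (step? t g g')) (isYes (possible₂? t g g'))

Realizable : ℕ → Kind → Fin 5 → Fin 5 → Set
Realizable 0 = Reachable₀
Realizable 1 = Step
Realizable 2 = Reachable₂
Realizable 3 = Reachable₃
Realizable _ = λ _ _ _ → ⊥

realizable? : ∀ k t g g' → Dec (Realizable k t g g')
realizable? 0 = reachable₀?
realizable? 1 = step?
realizable? 2 = reachable₂?
realizable? 3 = reachable₃?
realizable? (suc (suc (suc (suc _)))) _ _ _ = no λ ()

distance-realizable : ∀ t g g' → Realizable (distance t g g') t g g'
distance-realizable = from-yes (allKinds? λ t → all? λ g → all? λ g' → realizable? (distance t g g') t g g')

row₂-eccentricity : ∀ t g' → distance t 2F g' ≤ 2
row₂-eccentricity = from-yes (allKinds? λ t → all? λ g' → distance t 2F g' ≤? 2)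

EveryVertexBetween : Fin 5 → Fin 5 → Set
EveryVertexBetween g g'' = ∀ t g' → distance t g g' ≡ 0 ⊎ distance t g g' + distance t g' g'' ≡ distance equal g g''

everyVertexBetween? : ∀ g g'' → Dec (EveryVertexBetween g g'')
everyVertexBetween? g g'' = allKinds? λ t → all? λ g' →
  (distance t g g' ℕ.≟ 0) ⊎-dec (distance t g g' + distance t g' g'' ℕ.≟ distance equal g g'')

everyVertexBetween-0-3 : EveryVertexBetween 0F 3F
everyVertexBetween-0-3 = from-yes (everyVertexBetween? 0F 3F)

everyVertexBetween-1-4 : EveryVertexBetween 1F 4F
everyVertexBetween-1-4 = from-yes (everyVertexBetween? 1F 4F)

module ModularProductWithP₅ {m : ℕ} {_~_ : Rel (Fin (3 + m)) 0ℓ}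
  (_~?_ : Decidable _~_) (~-sym : Symmetric _~_) (triangleFree : TriangleFree _~_)
  (commonNonNeighbours : CommonNonNeighbours _~_) (noIsolatedEdge : NoIsolatedEdge _~_)
  (0~1 : 0F ~ 1F) (1~2 : 1F ~ 2F)
  where

  n : ℕ
  n = 3 + m

  H : Graph
  H = record { V = Fin n ; Adj = _~_ }

  M : Graph
  M = P 5 ⋄ H

  ~-irrefl : Irreflexive _≡_ _~_
  ~-irrefl refl x~x = triangleFree x~x x~x x~x

  open KindOf {A = Fin n} _≟_ _~?_

  kind-unique : ∀ {h h' t} → IsKind _~_ h h' t → kind h h' ≡ t
  kind-unique = IsKind-functional ~-irrefl (kind-view _ _)

  kind-refl : ∀ h → kind h h ≡ equal
  kind-refl h = kind-unique (is-equal refl)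

  kind-sym : ∀ h h' → kind h' h ≡ kind h h'
  kind-sym h h' = kind-unique (IsKind-sym ~-sym (kind-view h h'))

  d : V M → V M → ℕ
  d (g , h) (g' , h') = distance (kind h h') g g'

  Step⇒Adj : ∀ {g g' h h' t} → IsKind _~_ h h' t → Step t g g' → Adj M (g , h) (g' , h')
  Step⇒Adj = modular⇒Adj (kind₅-view _ _)

  Adj⇒Step : ∀ {g g' h h'} → Adj M (g , h) (g' , h') → Step (kind h h') g g'
  Adj⇒Step adj = Adj⇒modular P-irrefl ~-irrefl adj (kind₅-view _ _) (kind-view _ _)

  ⨾⇒Walk : ∀ {g g' h h₂ h' t₁ t₂} → IsKind _~_ h h₂ t₁ → IsKind _~_ h₂ h' t₂ →
           (Step t₁ ⨾ Step t₂) g g' → Walk M (g , h) (g' , h') 2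
  ⨾⇒Walk hh₂ h₂h' (_ , step₁ , step₂) = cons (Step⇒Adj hh₂ step₁) (cons (Step⇒Adj h₂h' step₂) nil)

  Walk⇒Possible₂ : ∀ {g g' h h'} → Walk M (g , h) (g' , h') 2 → Possible₂ (kind h h') g g'
  Walk⇒Possible₂ {h = h} {h'} (cons {y = g₂ , h₂} adj₁ (cons adj₂ nil)) =
    kind h h₂ , kind h₂ h' ,
    consistent-sound ~-sym triangleFree (kind-view h h₂) (kind-view h₂ h') (kind-view h h') ,
    g₂ , Adj⇒Step adj₁ , Adj⇒Step adj₂

  distance≤length : ∀ {g g' h h' k} → Walk M (g , h) (g' , h') k → distance (kind h h') g g' ≤ k
  distance≤length {h = h} nil                = firstTrue-≤₀ (fromWitness (refl , kind-refl h))
  distance≤length (cons adj nil)             = firstTrue-≤₁ (fromWitness (Adj⇒Step adj))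
  distance≤length walk@(cons _ (cons _ nil)) = firstTrue-≤₂ (fromWitness (Walk⇒Possible₂ walk))
  distance≤length (cons _ (cons _ (cons {k = k} _ _))) = ≤-trans (firstTrue-≤₃ _ _ _) (m≤m+n 3 k)

  walk-via-commonNonNeighbour : ∀ {g g'} h h' → (Step apart ⨾ Step apart) g g' → Walk M (g , h) (g' , h') 2
  walk-via-commonNonNeighbour h h' steps with f , f≢h , f≢h' , h≁f , h'≁f ← commonNonNeighbours h h' =
    ⨾⇒Walk (is-apart (f≢h ∘ sym) h≁f) (is-apart f≢h' (h'≁f ∘ ~-sym)) steps

  walk-via-edgeExtension : ∀ {g g' h h'} → h ~ h' → (Step adjacent ⨾ Step apart) g g' →
                           (Step apart ⨾ Step adjacent) g g' → Walk M (g , h) (g' , h') 2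
  walk-via-edgeExtension h~h' steps₁ steps₂ with noIsolatedEdge h~h'
  ... | w , inj₁ (h~w , w≢h') =
    ⨾⇒Walk (is-adjacent h~w) (is-apart w≢h' λ w~h' → triangleFree h~w w~h' h~h') steps₁
  ... | w , inj₂ (h'~w , w≢h) =
    ⨾⇒Walk (is-apart (w≢h ∘ sym) λ h~w → triangleFree h~w (~-sym h'~w) h~h') (is-adjacent (~-sym h'~w)) steps₂

  Realizable⇒Walk : ∀ k {g g' h h'} → Realizable k (kind h h') g g' → Walk M (g , h) (g' , h') k
  Realizable⇒Walk 0 {h = h} {h'} (refl , kind≡equal)
    with refl ← IsKind-equal (subst (IsKind _~_ h h') kind≡equal (kind-view h h')) = nil
  Realizable⇒Walk 1 step = cons (Step⇒Adj (kind-view _ _) step) nil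
  Realizable⇒Walk 2 {h = h} {h'} (inj₁ steps) = ⨾⇒Walk (is-equal refl) (kind-view h h') steps
  Realizable⇒Walk 2 {h = h} {h'} (inj₂ (inj₁ steps)) = ⨾⇒Walk (kind-view h h') (is-equal refl) steps
  Realizable⇒Walk 2 {h = h} {h'} (inj₂ (inj₂ (inj₁ steps))) = walk-via-commonNonNeighbour h h' steps
  Realizable⇒Walk 2 {h = h} {h'} (inj₂ (inj₂ (inj₂ (kind≡adjacent , steps₁ , steps₂)))) =
    walk-via-edgeExtension (IsKind-adjacent (subst (IsKind _~_ h h') kind≡adjacent (kind-view h h'))) steps₁ steps₂
  Realizable⇒Walk 3 (_ , step , steps) =
    cons (Step⇒Adj (is-equal refl) step) (⨾⇒Walk (is-equal refl) (kind-view _ _) steps)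

  dist : ∀ x y → Dist M x y (d x y)
  dist (g , h) (g' , h') =
    Realizable⇒Walk (d (g , h) (g' , h')) (distance-realizable (kind h h') g g') ,
    λ k k<d walk → <⇒≱ k<d (distance≤length walk)

  Dist⇒≡d : ∀ {x y k} → Dist M x y k → k ≡ d x y
  Dist⇒≡d D = Dist-unique D (dist _ _)

  geodesic : ∀ x y z → d x y + d y z ≡ d x z → OnGeodesic M x y z
  geodesic x y z eq = d x y , d y z , dist x y , dist y z , subst (Dist M x z) (sym eq) (dist x z)

  eccentricity≤3 : ∀ x → EccentricityAtMost x 3
  eccentricity≤3 _ _ D = subst (_≤ 3) (sym (Dist⇒≡d D)) (firstTrue-≤₃ _ _ _)

  EveryVertexBetween⇒OnGeodesic : ∀ {g g''} → EveryVertexBetween g g'' → ∀ h y → y ≢ (g , h) →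
                                   OnGeodesic M (g , h) y (g'' , h)
  -- Eliminating the disjunction by with instead would make Agda normalise the
  -- distance table inside the goal, which is very slow.
  EveryVertexBetween⇒OnGeodesic {g} {g''} between h (g' , h') y≢x =
    [ (λ d≡0 → contradiction (sym (Dist-0⇒≡ (subst (Dist M x y) d≡0 (dist x y)))) y≢x) ,
      geodesic x y z ∘ tight ]′ (between (kind h h') g')
    where
    x y z : V M
    x = g , h
    y = g' , h'
    z = g'' , h

    tight : distance (kind h h') g g' + distance (kind h h') g' g'' ≡ distance equal g g'' → d x y + d y z ≡ d x z
    tight eq = begin
      distance (kind h h') g g' + distance (kind h' h) g' g''
        ≡⟨ cong (λ t → distance (kind h h') g g' + distance t g' g'') (kind-sym h h') ⟩
      distance (kind h h') g g' + distance (kind h h') g' g'' ≡⟨ eq ⟩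
      distance equal g g''                                    ≡⟨ cong (λ t → distance t g g'') (kind-refl h) ⟨
      distance (kind h h) g g''                               ∎
      where open ≡-Reasoning

  hub-geodesic : OnGeodesic M (2F , 0F) (2F , 1F) (2F , 2F)
  hub-geodesic = geodesic (2F , 0F) (2F , 1F) (2F , 2F) (begin
    distance (kind 0F 1F) 2F 2F + distance (kind 1F 2F) 2F 2F
      ≡⟨ cong₂ (λ s t → distance s 2F 2F + distance t 2F 2F) (kind-unique (is-adjacent 0~1)) (kind-unique (is-adjacent 1~2)) ⟩
    distance adjacent 2F 2F + distance adjacent 2F 2F
      ≡⟨ cong (λ t → distance t 2F 2F) (kind-unique (is-apart (λ ()) (triangleFree 0~1 1~2))) ⟨
    distance (kind 0F 2F) 2F 2F ∎)
    where open ≡-Reasoning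

  row : Fin 5 → List (Fin n) → List (V M)
  row g = map (g ,_)

  ∈-row⁻ : ∀ {x g hs} → x ∈ row g hs → proj₁ x ≡ g
  ∈-row⁻ {g = g} x∈ with _ , _ , refl ← ∈-map⁻ (g ,_) x∈ = refl

  rows-disjoint : ∀ {g g' hs hs'} → g ≢ g' → Disjoint (row g hs) (row g' hs')
  rows-disjoint g≢g' (x∈ , x∈') = g≢g' (trans (sym (∈-row⁻ x∈)) (∈-row⁻ x∈'))

  row-unique : ∀ {g hs} → Unique hs → Unique (row g hs)
  row-unique = Unique.map⁺ (cong proj₂)

  row₂-rest : List (Fin n)
  row₂-rest = map (Fin.suc ∘ Fin.suc) (allFin (suc m))

  length-allRow : ∀ g → length (row g (allFin n)) ≡ n
  length-allRow g = trans (length-map (g ,_) (allFin n)) (length-tabulate {n = n} id)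

  length-row₂-rest : length (row 2F row₂-rest) ≡ n ∸ 2
  length-row₂-rest = trans (length-map (2F ,_) row₂-rest)
                           (trans (length-map (Fin.suc ∘ Fin.suc) (allFin (suc m))) (length-tabulate {n = suc m} id))

  S₀ : List (V M)
  S₀ = row 3F (allFin n) ++ row 4F (allFin n) ++ row 2F row₂-rest

  ∈S₀-row₃ : ∀ h → (3F , h) ∈ S₀
  ∈S₀-row₃ h = ∈-++⁺ˡ (∈-map⁺ (3F ,_) (∈-allFin h))

  ∈S₀-row₄ : ∀ h → (4F , h) ∈ S₀
  ∈S₀-row₄ h = ∈-++⁺ʳ (row 3F (allFin n)) (∈-++⁺ˡ (∈-map⁺ (4F ,_) (∈-allFin h)))

  ∈S₀-row₂ : ∀ i → (2F , suc (suc i)) ∈ S₀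
  ∈S₀-row₂ i = ∈-++⁺ʳ (row 3F (allFin n)) (∈-++⁺ʳ (row 4F (allFin n))
                 (∈-map⁺ (2F ,_) (∈-map⁺ (Fin.suc ∘ Fin.suc) (∈-allFin i))))

  S₀-unique : Unique S₀
  S₀-unique =
    Unique.++⁺ (row-unique (Unique.allFin⁺ n))
      (Unique.++⁺ (row-unique (Unique.allFin⁺ n))
                  (row-unique (Unique.map⁺ (Finₚ.suc-injective ∘ Finₚ.suc-injective) (Unique.allFin⁺ (suc m))))
                  (rows-disjoint λ ()))
      λ (x∈₃ , x∈₄₂) → [ (λ x∈₄ → rows-disjoint (λ ()) (x∈₃ , x∈₄))
                       , (λ x∈₂ → rows-disjoint (λ ()) (x∈₃ , x∈₂)) ]′ (∈-++⁻ (row 4F (allFin n)) x∈₄₂)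

  S₀-length : length S₀ ≡ n + (n + (n ∸ 2))
  S₀-length = begin
    length S₀
      ≡⟨ length-++ (row 3F (allFin n)) ⟩
    length (row 3F (allFin n)) + length (row 4F (allFin n) ++ row 2F row₂-rest)
      ≡⟨ cong (length (row 3F (allFin n)) +_) (length-++ (row 4F (allFin n))) ⟩
    length (row 3F (allFin n)) + (length (row 4F (allFin n)) + length (row 2F row₂-rest))
      ≡⟨ cong₂ _+_ (length-allRow 3F) (cong₂ _+_ (length-allRow 4F) length-row₂-rest) ⟩
    n + (n + (n ∸ 2))
      ∎
    where open ≡-Reasoning

  data Outside : V M → Set where
    row₀ : ∀ h → Outside (0F , h)
    row₁ : ∀ h → Outside (1F , h)
    hub₀ : Outside (2F , 0F)
    hub₁ : Outside (2F , 1F)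

  S₀-or-Outside : ∀ x → x ∈ S₀ ⊎ Outside x
  S₀-or-Outside (0F , h)           = inj₂ (row₀ h)
  S₀-or-Outside (1F , h)           = inj₂ (row₁ h)
  S₀-or-Outside (2F , 0F)          = inj₂ hub₀
  S₀-or-Outside (2F , 1F)          = inj₂ hub₁
  S₀-or-Outside (2F , suc (suc i)) = inj₁ (∈S₀-row₂ i)
  S₀-or-Outside (3F , h)           = inj₁ (∈S₀-row₃ h)
  S₀-or-Outside (4F , h)           = inj₁ (∈S₀-row₄ h)

  onGeodesic-to-row₃ : ∀ h y → y ≢ (0F , h) → OnGeodesic M (0F , h) y (3F , h)
  onGeodesic-to-row₃ = EveryVertexBetween⇒OnGeodesic everyVertexBetween-0-3

  onGeodesic-to-row₄ : ∀ h y → y ≢ (1F , h) → OnGeodesic M (1F , h) y (4F , h)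
  onGeodesic-to-row₄ = EveryVertexBetween⇒OnGeodesic everyVertexBetween-1-4

  S₀-resolving : StrongResolvingSet M S₀
  S₀-resolving x y x≢y with S₀-or-Outside x | S₀-or-Outside y
  ... | inj₁ x∈S₀     | _             = x , x∈S₀ , inj₁ (OnGeodesic-end (dist y x))
  ... | _             | inj₁ y∈S₀     = y , y∈S₀ , inj₂ (OnGeodesic-end (dist x y))
  ... | inj₂ (row₀ h) | _             = (3F , h) , ∈S₀-row₃ h , inj₂ (onGeodesic-to-row₃ h y (x≢y ∘ sym))
  ... | inj₂ (row₁ h) | _             = (4F , h) , ∈S₀-row₄ h , inj₂ (onGeodesic-to-row₄ h y (x≢y ∘ sym))
  ... | _             | inj₂ (row₀ h) = (3F , h) , ∈S₀-row₃ h , inj₁ (onGeodesic-to-row₃ h x x≢y)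
  ... | _             | inj₂ (row₁ h) = (4F , h) , ∈S₀-row₄ h , inj₁ (onGeodesic-to-row₄ h x x≢y)
  ... | inj₂ hub₀     | inj₂ hub₀     = contradiction refl x≢y
  ... | inj₂ hub₀     | inj₂ hub₁     = (2F , 2F) , ∈S₀-row₂ 0F , inj₂ hub-geodesic
  ... | inj₂ hub₁     | inj₂ hub₀     = (2F , 2F) , ∈S₀-row₂ 0F , inj₁ hub-geodesic
  ... | inj₂ hub₁     | inj₂ hub₁     = contradiction refl x≢y

  dist-column : ∀ g g' h → Dist M (g , h) (g' , h) (distance equal g g')
  dist-column g g' h = subst (λ t → Dist M (g , h) (g' , h) (distance t g g')) (kind-refl h) (dist (g , h) (g' , h))

  diametral-pair-∈ : ∀ {S} → StrongResolvingSet M S → ∀ {g g'} → g ≢ g' →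
                     distance equal g g' ≡ 3 → distance equal g' g ≡ 3 → ∀ h → (g , h) ∈ S ⊎ (g' , h) ∈ S
  diametral-pair-∈ resolving {g} {g'} g≢g' d≡3 d'≡3 h =
    mutuallyMaximallyDistant-∈ resolving (g≢g' ∘ cong proj₁)
      (subst (Dist M (g , h) (g' , h)) d≡3 (dist-column g g' h)) (subst (Dist M (g' , h) (g , h)) d'≡3 (dist-column g' g h))
      (eccentricity≤3 (g , h)) (eccentricity≤3 (g' , h))

  row₂-nonEdge-∈ : ∀ {S} → StrongResolvingSet M S → ∀ {h h'} → h ≢ h' → ¬ h ~ h' → (2F , h) ∈ S ⊎ (2F , h') ∈ S
  row₂-nonEdge-∈ resolving {h} {h'} h≢h' h≁h' =
    mutuallyMaximallyDistant-∈ resolving (h≢h' ∘ cong proj₂)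
      (dist-apart h≢h' h≁h') (dist-apart (h≢h' ∘ sym) (h≁h' ∘ ~-sym)) (eccentricity≤2 h) (eccentricity≤2 h')
    where
    dist-apart : ∀ {h h'} → h ≢ h' → ¬ h ~ h' → Dist M (2F , h) (2F , h') 2
    dist-apart {h} {h'} h≢h' h≁h' =
      subst (λ t → Dist M (2F , h) (2F , h') (distance t 2F 2F)) (kind-unique (is-apart h≢h' h≁h')) (dist (2F , h) (2F , h'))

    eccentricity≤2 : ∀ h → EccentricityAtMost (2F , h) 2
    eccentricity≤2 h (g' , h') D = subst (_≤ 2) (sym (Dist⇒≡d D)) (row₂-eccentricity (kind h h') g')

  InRows : Fin 5 → Fin 5 → Pred (V M) 0ℓ
  InRows g g' x = proj₁ x ≡ g ⊎ proj₁ x ≡ g'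

  inRows? : ∀ g g' → U.Decidable (InRows g g')
  inRows? g g' x = (proj₁ x ≟ g) ⊎-dec (proj₁ x ≟ g')

  ∈-outsideRows : ∀ {x xs g g'} → x ∈ xs → proj₁ x ≢ g → proj₁ x ≢ g' → x ∈ filter (∁? (inRows? g g')) xs
  ∈-outsideRows {g = g} {g'} x∈ ≢g ≢g' = ∈-filter⁺ (∁? (inRows? g g')) x∈ [ ≢g , ≢g' ]′

  length-inRows : ∀ {g g'} xs → (∀ h → (g , h) ∈ xs ⊎ (g' , h) ∈ xs) → n ≤ length (filter (inRows? g g') xs)
  length-inRows {g} {g'} xs covers =
    subst (n ≤_) (length-map proj₂ inRows) (pigeonhole-length id id (map proj₂ inRows) (∈-column ∘ covers))
    where
    inRows : List (V M)
    inRows = filter (inRows? g g') xs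

    ∈-column : ∀ {h} → (g , h) ∈ xs ⊎ (g' , h) ∈ xs → h ∈ map proj₂ inRows
    ∈-column = [ (λ p → ∈-map⁺ proj₂ (∈-filter⁺ (inRows? g g') p (inj₁ refl)))
               , (λ p → ∈-map⁺ proj₂ (∈-filter⁺ (inRows? g g') p (inj₂ refl))) ]′

  lower-bound : ∀ S → StrongResolvingSet M S → 3 * n ∸ 2 ≤ length S
  lower-bound S resolving = begin
    3 * n ∸ 2                             ≡⟨ 3*n∸2≡n+[n+[n∸2]] n (s≤s (s≤s z≤n)) ⟩
    n + (n + (n ∸ 2))                     ≤⟨ +-mono-≤ n≤S₀₃ (+-mono-≤ n≤S₁₄ (m≤n+o⇒m∸n≤o n 2 n≤2+S₂)) ⟩
    length S₀₃ + (length S₁₄ + length S₂) ≡⟨ cong (length S₀₃ +_) (length-filter-∁ (inRows? 1F 4F) S′) ⟩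
    length S₀₃ + length S′                ≡⟨ length-filter-∁ (inRows? 0F 3F) S ⟩
    length S                              ∎
    where
    open ≤-Reasoning
    S₀₃ S′ S₁₄ S₂ : List (V M)
    S₀₃ = filter (inRows? 0F 3F) S
    S′  = filter (∁? (inRows? 0F 3F)) S
    S₁₄ = filter (inRows? 1F 4F) S′
    S₂  = filter (∁? (inRows? 1F 4F)) S′

    n≤S₀₃ : n ≤ length S₀₃
    n≤S₀₃ = length-inRows S (diametral-pair-∈ resolving (λ ()) refl refl)

    n≤S₁₄ : n ≤ length S₁₄
    n≤S₁₄ = length-inRows S′ (map-⊎ (λ p → ∈-outsideRows p (λ ()) (λ ())) (λ p → ∈-outsideRows p (λ ()) (λ ()))
                              ∘ diametral-pair-∈ resolving (λ ()) refl refl)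

    n≤2+S₂ : n ≤ 2 + length S₂
    n≤2+S₂ = subst (λ k → n ≤ 2 + k) (length-map proj₂ S₂) (nonEdgeCover-length _~?_ triangleFree (map proj₂ S₂) covers)
      where
      keep : ∀ {h} → (2F , h) ∈ S → h ∈ map proj₂ S₂
      keep p = ∈-map⁺ proj₂ (∈-outsideRows (∈-outsideRows p (λ ()) (λ ())) (λ ()) (λ ()))

      covers : ∀ {h h'} → h ≢ h' → ¬ h ~ h' → h ∈ map proj₂ S₂ ⊎ h' ∈ map proj₂ S₂
      covers h≢h' h≁h' = map-⊎ keep keep (row₂-nonEdge-∈ resolving h≢h' h≁h')

  strongMetricDim : StrongMetricDim M (3 * n ∸ 2)
  strongMetricDim =
    (S₀ , S₀-unique , trans S₀-length (sym (3*n∸2≡n+[n+[n∸2]] n (s≤s (s≤s z≤n)))) , S₀-resolving) ,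
    λ S _ → lower-bound S

P-sym : ∀ {n} → Symmetric (Adj (P n))
P-sym (inj₁ j≡1+i) = inj₂ j≡1+i
P-sym (inj₂ i≡1+j) = inj₁ i≡1+j

C-adj? : ∀ n → Decidable (Adj (C n))
C-adj? n i j = (toℕ j ℕ.≟ suc (toℕ i)) ⊎-dec (toℕ i ℕ.≟ suc (toℕ j))
       ⊎-dec (toℕ i ℕ.≟ 0) ×-dec (suc (toℕ j) ℕ.≟ n) ⊎-dec (toℕ j ℕ.≟ 0) ×-dec (suc (toℕ i) ℕ.≟ n)

C-sym : ∀ {n} → Symmetric (Adj (C n))
C-sym (inj₁ j≡1+i)              = inj₂ (inj₁ j≡1+i)
C-sym (inj₂ (inj₁ i≡1+j))       = inj₁ i≡1+j
C-sym (inj₂ (inj₂ (inj₁ wrap))) = inj₂ (inj₂ (inj₂ wrap))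
C-sym (inj₂ (inj₂ (inj₂ wrap))) = inj₂ (inj₂ (inj₁ wrap))

P⊆C : ∀ {n i j} → Adj (P n) i j → Adj (C n) i j
P⊆C (inj₁ j≡1+i) = inj₁ j≡1+i
P⊆C (inj₂ i≡1+j) = inj₂ (inj₁ i≡1+j)

-- Adj (C n) i j is CycleAdj n (toℕ i) (toℕ j); over ℕ the equations can be matched on.
CycleAdj : ℕ → ℕ → ℕ → Set
CycleAdj n a b = (b ≡ suc a) ⊎ (a ≡ suc b) ⊎ ((a ≡ 0) × (suc b ≡ n)) ⊎ ((b ≡ 0) × (suc a ≡ n))

cycle-triangleFree : ∀ {k} → TriangleFree (CycleAdj (4 + k))
cycle-triangleFree (inj₁ refl) (inj₁ refl) =
  λ { (inj₁ ()) ; (inj₂ (inj₁ ())) ; (inj₂ (inj₂ (inj₁ (refl , ())))) ; (inj₂ (inj₂ (inj₂ (() , _)))) }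
cycle-triangleFree (inj₁ refl) (inj₂ (inj₁ refl)) =
  λ { (inj₁ ()) ; (inj₂ (inj₁ ())) ; (inj₂ (inj₂ (inj₁ (refl , ())))) ; (inj₂ (inj₂ (inj₂ (refl , ())))) }
cycle-triangleFree (inj₁ refl) (inj₂ (inj₂ (inj₁ (() , _))))
cycle-triangleFree (inj₁ refl) (inj₂ (inj₂ (inj₂ (refl , refl)))) =
  λ { (inj₁ ()) ; (inj₂ (inj₁ ())) ; (inj₂ (inj₂ (inj₁ (() , _)))) ; (inj₂ (inj₂ (inj₂ (refl , ())))) }
cycle-triangleFree (inj₂ (inj₁ refl)) (inj₁ refl) =
  λ { (inj₁ ()) ; (inj₂ (inj₁ ())) ; (inj₂ (inj₂ (inj₁ (() , _)))) ; (inj₂ (inj₂ (inj₂ (() , _)))) }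
cycle-triangleFree (inj₂ (inj₁ refl)) (inj₂ (inj₁ refl)) =
  λ { (inj₁ ()) ; (inj₂ (inj₁ ())) ; (inj₂ (inj₂ (inj₁ (() , _)))) ; (inj₂ (inj₂ (inj₂ (refl , ())))) }
cycle-triangleFree (inj₂ (inj₁ refl)) (inj₂ (inj₂ (inj₁ (refl , refl)))) =
  λ { (inj₁ ()) ; (inj₂ (inj₁ ())) ; (inj₂ (inj₂ (inj₁ (() , _)))) ; (inj₂ (inj₂ (inj₂ (() , _)))) }
cycle-triangleFree (inj₂ (inj₁ refl)) (inj₂ (inj₂ (inj₂ (refl , refl)))) =
  λ { (inj₁ ()) ; (inj₂ (inj₁ ())) ; (inj₂ (inj₂ (inj₁ (() , _)))) ; (inj₂ (inj₂ (inj₂ (refl , ())))) }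
cycle-triangleFree (inj₂ (inj₂ (inj₁ (refl , refl)))) (inj₁ refl) =
  λ { (inj₁ ()) ; (inj₂ (inj₁ ())) ; (inj₂ (inj₂ (inj₁ (refl , ())))) ; (inj₂ (inj₂ (inj₂ (() , _)))) }
cycle-triangleFree (inj₂ (inj₂ (inj₁ (refl , refl)))) (inj₂ (inj₁ refl)) =
  λ { (inj₁ ()) ; (inj₂ (inj₁ ())) ; (inj₂ (inj₂ (inj₁ (refl , ())))) ; (inj₂ (inj₂ (inj₂ (() , _)))) }
cycle-triangleFree (inj₂ (inj₂ (inj₁ (refl , refl)))) (inj₂ (inj₂ (inj₁ (() , _))))
cycle-triangleFree (inj₂ (inj₂ (inj₁ (refl , refl)))) (inj₂ (inj₂ (inj₂ (refl , refl)))) =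
  λ { (inj₁ ()) ; (inj₂ (inj₁ ())) ; (inj₂ (inj₂ (inj₁ (refl , ())))) ; (inj₂ (inj₂ (inj₂ (refl , ())))) }
cycle-triangleFree (inj₂ (inj₂ (inj₂ (refl , refl)))) (inj₁ refl) =
  λ { (inj₁ ()) ; (inj₂ (inj₁ ())) ; (inj₂ (inj₂ (inj₁ (() , _)))) ; (inj₂ (inj₂ (inj₂ (() , _)))) }
cycle-triangleFree (inj₂ (inj₂ (inj₂ (refl , refl)))) (inj₂ (inj₁ ()))
cycle-triangleFree (inj₂ (inj₂ (inj₂ (refl , refl)))) (inj₂ (inj₂ (inj₁ (refl , refl)))) =
  λ { (inj₁ ()) ; (inj₂ (inj₁ ())) ; (inj₂ (inj₂ (inj₁ (() , _)))) ; (inj₂ (inj₂ (inj₂ (() , _)))) }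
cycle-triangleFree (inj₂ (inj₂ (inj₂ (refl , refl)))) (inj₂ (inj₂ (inj₂ (refl , ()))))

C-triangleFree : ∀ {k} → TriangleFree (Adj (C (4 + k)))
C-triangleFree = cycle-triangleFree

P-triangleFree : ∀ {k} → TriangleFree (Adj (P (4 + k)))
P-triangleFree x~y y~z x~z = C-triangleFree (P⊆C x~y) (P⊆C y~z) (P⊆C x~z)

module _ {k} {_~_ : Rel (Fin (7 + k)) 0ℓ} where
  open import Data.List.Membership.DecPropositional ℕ._≟_ using (_∈?_; _∉?_)

  -- Of the seven vertices 0, …, 6 at most six lie in the closed neighbourhoods of x and y.
  commonNonNeighbours-of-maxDegree≤2 : (N : Fin (7 + k) → List ℕ) → (∀ x → length (N x) ≤ 3) →
    (∀ x → toℕ x ∈ N x) → (∀ {x y} → x ~ y → toℕ y ∈ N x) → CommonNonNeighbours _~_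
  commonNonNeighbours-of-maxDegree≤2 N N≤3 self∈N nbr∈N x y with any? (λ (c : Fin 7) → toℕ c ∉? N x ++ N y)
  ... | yes (c , c∉) = f , f≢ (∈-++⁺ˡ (self∈N x)) , f≢ (∈-++⁺ʳ (N x) (self∈N y)) ,
                       f∉ ∘ ∈-++⁺ˡ ∘ nbr∈N , f∉ ∘ ∈-++⁺ʳ (N x) ∘ nbr∈N
    where
    f : Fin (7 + k)
    f = Fin.inject≤ c (m≤m+n 7 k)

    f∉ : toℕ f ∉ N x ++ N y
    f∉ = subst (_∉ N x ++ N y) (sym (Finₚ.toℕ-inject≤ c (m≤m+n 7 k))) c∉

    f≢ : ∀ {z} → toℕ z ∈ N x ++ N y → f ≢ z
    f≢ z∈ refl = f∉ z∈
  ... | no none = ⊥-elim (1+n≰n (≤-trans seven≤ (+-mono-≤ (N≤3 x) (N≤3 y))))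
    where
    seven≤ : 7 ≤ length (N x) + length (N y)
    seven≤ = subst (7 ≤_) (length-++ (N x))
               (pigeonhole-length toℕ Finₚ.toℕ-injective (N x ++ N y)
                 λ c → decidable-stable (toℕ c ∈? N x ++ N y) λ c∉ → none (c , c∉))

cycle-next : ℕ → ℕ → ℕ
cycle-next n a with suc a ℕ.≟ n
... | yes _ = 0
... | no  _ = suc a

cycle-prev : ℕ → ℕ → ℕ
cycle-prev n zero    = ℕ.pred n
cycle-prev n (suc a) = a

C-neighbour∈ : ∀ {n} {x y : Fin n} → Adj (C n) x y →
               toℕ y ∈ toℕ x ∷ cycle-next n (toℕ x) ∷ cycle-prev n (toℕ x) ∷ []
C-neighbour∈ {n} {x} {y} (inj₁ y≡1+x) with suc (toℕ x) ℕ.≟ n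
... | yes 1+x≡n = contradiction (trans y≡1+x 1+x≡n) (<⇒≢ (Finₚ.toℕ<n y))
... | no  _     = there (here y≡1+x)
C-neighbour∈ {n} (inj₂ (inj₁ x≡1+y)) = there (there (here (sym (cong (cycle-prev n) x≡1+y))))
C-neighbour∈ {n} (inj₂ (inj₂ (inj₁ (x≡0 , 1+y≡n)))) =
  there (there (here (trans (cong ℕ.pred 1+y≡n) (sym (cong (cycle-prev n) x≡0)))))
C-neighbour∈ {n} {x} (inj₂ (inj₂ (inj₂ (y≡0 , 1+x≡n)))) with suc (toℕ x) ℕ.≟ n
... | yes _     = there (here y≡0)
... | no  1+x≢n = contradiction 1+x≡n 1+x≢n

C-commonNonNeighbours : ∀ {k} → CommonNonNeighbours (Adj (C (7 + k)))
C-commonNonNeighbours =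
  commonNonNeighbours-of-maxDegree≤2 (λ x → toℕ x ∷ cycle-next _ (toℕ x) ∷ cycle-prev _ (toℕ x) ∷ [])
                                     (λ _ → ≤-refl) (λ _ → here refl) C-neighbour∈

P-commonNonNeighbours : ∀ {k} → CommonNonNeighbours (Adj (P (7 + k)))
P-commonNonNeighbours x y with f , f≢x , f≢y , x≁f , y≁f ← C-commonNonNeighbours x y =
  f , f≢x , f≢y , x≁f ∘ P⊆C , y≁f ∘ P⊆C

P-extendEdge : ∀ {k} (i j : Fin (3 + k)) → toℕ j ≡ suc (toℕ i) →
               ∃[ w ] ((Adj (P (3 + k)) i w × w ≢ j) ⊎ (Adj (P (3 + k)) j w × w ≢ i))
P-extendEdge zero    j j≡1   = 2F , inj₂ (inj₁ (cong suc (sym j≡1)) , λ ())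
P-extendEdge (suc i) j j≡2+i = Fin.inject₁ i , inj₁ (inj₂ (cong suc (sym (Finₚ.toℕ-inject₁ i))) ,
  λ i≡j → m≢1+n+m (toℕ i) (trans (trans (sym (Finₚ.toℕ-inject₁ i)) (cong toℕ i≡j)) j≡2+i))

P-noIsolatedEdge : ∀ {k} → NoIsolatedEdge (Adj (P (3 + k)))
P-noIsolatedEdge (inj₁ y≡1+x) = P-extendEdge _ _ y≡1+x
P-noIsolatedEdge (inj₂ x≡1+y) = map₂ swap (P-extendEdge _ _ x≡1+y)

C-noIsolatedEdge : ∀ {k} → NoIsolatedEdge (Adj (C (3 + k)))
C-noIsolatedEdge (inj₁ y≡1+x)        = map₂ (map-⊎ (map₁ P⊆C) (map₁ P⊆C)) (P-noIsolatedEdge (inj₁ y≡1+x))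
C-noIsolatedEdge (inj₂ (inj₁ x≡1+y)) = map₂ (map-⊎ (map₁ P⊆C) (map₁ P⊆C)) (P-noIsolatedEdge (inj₂ x≡1+y))
C-noIsolatedEdge (inj₂ (inj₂ (inj₁ (x≡0 , 1+y≡n)))) =
  1F , inj₁ (inj₁ (cong suc (sym x≡0)) , λ 1≡y → contradiction (trans (cong (suc ∘ toℕ) 1≡y) 1+y≡n) λ ())
C-noIsolatedEdge (inj₂ (inj₂ (inj₂ (y≡0 , 1+x≡n)))) =
  1F , inj₂ (inj₁ (cong suc (sym y≡0)) , λ 1≡x → contradiction (trans (cong (suc ∘ toℕ) 1≡x) 1+x≡n) λ ())

path-strongMetricDim : ∀ k → StrongMetricDim (P 5 ⋄ P (7 + k)) (3 * (7 + k) ∸ 2)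
path-strongMetricDim k = ModularProductWithP₅.strongMetricDim
  (P-adj? (7 + k)) P-sym P-triangleFree P-commonNonNeighbours P-noIsolatedEdge (inj₁ refl) (inj₁ refl)

cycle-strongMetricDim : ∀ k → StrongMetricDim (P 5 ⋄ C (7 + k)) (3 * (7 + k) ∸ 2)
cycle-strongMetricDim k = ModularProductWithP₅.strongMetricDim
  (C-adj? (7 + k)) C-sym C-triangleFree C-commonNonNeighbours C-noIsolatedEdge (inj₁ refl) (inj₁ refl)

corollary4p14 : (r : ℕ) → 7 ≤ r →
    StrongMetricDim (P 5 ⋄ P r) (3 * r ∸ 2) × StrongMetricDim (P 5 ⋄ C r) (3 * r ∸ 2)
corollary4p14 r 7≤r with k , refl ← m≤n⇒∃[o]m+o≡n 7≤r = path-strongMetricDim k , cycle-strongMetricDim k
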